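{- Let $\alpha$ be a simple type and $m\in\mathbb{N}$ with $m>h(\alpha\to\alpha)$. Then the function $e_m:\mathbb{N}\to\mathbb{N}$, $e_m(n)=1$ if $n=m$ and $e_m(n)=0$ otherwise, is not $\alpha$-definable in the $\lambda\mathrm{Y}$-calculus.
   Context: Simple types are built from a ground type $o$ with $\to$. The $\lambda\mathrm{Y}$-calculus is the typed (Church-style) $\lambda\beta\eta$-calculus extended with constants $\mathrm{Y}_\sigma:(\sigma\to\sigma)\to\sigma$ for every type $\sigma$ and conversions $f(\mathrm{Y}_\sigma f)=\mathrm{Y}_\sigma f$. For a type $\alpha$, $\omega_\alpha=(\alpha\to\alpha)\to(\alpha\to\alpha)$ and $\underline{m}_\alpha=\lambda f^{\alpha\to\alpha}.\lambda x^\alpha.f^m(x)$. A closed term $F:\omega_\alpha\to\omega_\alpha$ $\alpha$-defines $f:\mathbb{N}\to\mathbb{N}$ in $\lambda\mathrm{Y}$ iff for all $n,m$: $f(n)=m$ iff $\vdash_{\lambda\mathrm{Y}}F\,\underline{n}_\alpha=\underline{m}_\alpha$. Let $\mathcal{O}_o=\{\perp,\top\}$ with $\perp\le\top$ and $\mathcal{O}_{\sigma\to\tau}$ the finite poset of monotone maps $\mathcal{O}_\sigma\to\mathcal{O}_\tau$ ordered pointwise; $h(\sigma)$ is the maximal length $n$ of a strictly ascending chain $x_0<\cdots<x_n$ in $\mathcal{O}_\sigma$. -}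

module Defs where

open import Data.Nat using (ℕ; zero; suc; _<_; _≤_; _≡ᵇ_)
open import Data.Bool using (Bool; true; false; if_then_else_)
open import Data.List using (List; []; _∷_)
open import Data.Product using (Σ; _×_; _,_)
open import Relation.Nullary using (¬_)
open import Relation.Binary.PropositionalEquality using (_≡_)

infixr 7 _⇒_
data Ty : Set where
  o   : Ty
  _⇒_ : Ty → Ty → Ty

Ctx : Set
Ctx = List Ty

-- de Bruijn variables (head of the list = most recently bound)
data _∋_ : Ctx → Ty → Set where
  Z : ∀ {Γ σ} → (σ ∷ Γ) ∋ σ
  S : ∀ {Γ σ τ} → Γ ∋ σ → (τ ∷ Γ) ∋ σ

data Tm : Ctx → Ty → Set where
  var : ∀ {Γ σ} → Γ ∋ σ → Tm Γ σ
  lam : ∀ {Γ σ τ} → Tm (σ ∷ Γ) τ → Tm Γ (σ ⇒ τ)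
  app : ∀ {Γ σ τ} → Tm Γ (σ ⇒ τ) → Tm Γ σ → Tm Γ τ
  Y   : ∀ {Γ} (σ : Ty) → Tm Γ ((σ ⇒ σ) ⇒ σ)

ext : ∀ {Γ Δ} → (∀ {σ} → Γ ∋ σ → Δ ∋ σ) → ∀ {σ τ} → (τ ∷ Γ) ∋ σ → (τ ∷ Δ) ∋ σ
ext ρ Z     = Z
ext ρ (S x) = S (ρ x)

rename : ∀ {Γ Δ} → (∀ {σ} → Γ ∋ σ → Δ ∋ σ) → ∀ {σ} → Tm Γ σ → Tm Δ σ
rename ρ (var x)   = var (ρ x)
rename ρ (lam M)   = lam (rename (ext ρ) M)
rename ρ (app M N) = app (rename ρ M) (rename ρ N)
rename ρ (Y σ)     = Y σ

weaken : ∀ {Γ σ τ} → Tm Γ σ → Tm (τ ∷ Γ) σ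
weaken = rename S

exts : ∀ {Γ Δ} → (∀ {σ} → Γ ∋ σ → Tm Δ σ) → ∀ {σ τ} → (τ ∷ Γ) ∋ σ → Tm (τ ∷ Δ) σ
exts s Z     = var Z
exts s (S x) = weaken (s x)

subst : ∀ {Γ Δ} → (∀ {σ} → Γ ∋ σ → Tm Δ σ) → ∀ {σ} → Tm Γ σ → Tm Δ σ
subst s (var x)   = s x
subst s (lam M)   = lam (subst (exts s) M)
subst s (app M N) = app (subst s M) (subst s N)
subst s (Y σ)     = Y σ

single : ∀ {Γ τ} → Tm Γ τ → ∀ {σ} → (τ ∷ Γ) ∋ σ → Tm Γ σ
single N Z     = N
single N (S x) = var x

_[_] : ∀ {Γ σ τ} → Tm (τ ∷ Γ) σ → Tm Γ τ → Tm Γ σ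
M [ N ] = subst (single N) M

infix 4 _≈_
data _≈_ {Γ : Ctx} : ∀ {σ} → Tm Γ σ → Tm Γ σ → Set where
  β     : ∀ {σ τ} (M : Tm (σ ∷ Γ) τ) (N : Tm Γ σ) → app (lam M) N ≈ M [ N ]
  η     : ∀ {σ τ} (M : Tm Γ (σ ⇒ τ)) → lam (app (weaken M) (var Z)) ≈ M
  Yc    : ∀ {σ} (f : Tm Γ (σ ⇒ σ)) → app f (app (Y σ) f) ≈ app (Y σ) f
  ≈refl  : ∀ {σ} {M : Tm Γ σ} → M ≈ M
  ≈sym   : ∀ {σ} {M N : Tm Γ σ} → M ≈ N → N ≈ M
  ≈trans : ∀ {σ} {M N P : Tm Γ σ} → M ≈ N → N ≈ P → M ≈ P
  ξlam  : ∀ {σ τ} {M N : Tm (σ ∷ Γ) τ} → M ≈ N → lam M ≈ lam N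
  ξapp  : ∀ {σ τ} {M M' : Tm Γ (σ ⇒ τ)} {N N' : Tm Γ σ} →
          M ≈ M' → N ≈ N' → app M N ≈ app M' N'

ω : Ty → Ty
ω α = (α ⇒ α) ⇒ (α ⇒ α)

iter : ∀ {α} → ℕ → Tm (α ∷ (α ⇒ α) ∷ []) α
iter zero    = var Z
iter (suc m) = app (var (S Z)) (iter m)

num : (α : Ty) → ℕ → Tm [] (ω α)
num α m = lam (lam (iter m))

Defines : (α : Ty) → Tm [] (ω α ⇒ ω α) → (ℕ → ℕ) → Set
Defines α F f = ∀ n m → (f n ≡ m → app F (num α n) ≈ num α m)
                      × (app F (num α n) ≈ num α m → f n ≡ m)

Definable : (α : Ty) → (ℕ → ℕ) → Set
Definable α f = Σ (Tm [] (ω α ⇒ ω α)) (λ F → Defines α F f)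

data _≤B_ : Bool → Bool → Set where
  ff≤ : ∀ {b} → false ≤B b
  tt≤tt : true ≤B true

mutual
  O : Ty → Set
  O o       = Bool               -- ⊥ = false, ⊤ = true
  O (σ ⇒ τ) = Σ (O σ → O τ) (λ f → ∀ x y → Le σ x y → Le τ (f x) (f y))

  Le : (σ : Ty) → O σ → O σ → Set
  Le o       a b             = a ≤B b
  Le (σ ⇒ τ) (f , _) (g , _) = ∀ x → Le τ (f x) (g x)

Lt : (σ : Ty) → O σ → O σ → Set
Lt σ x y = Le σ x y × ¬ Le σ y x

-- a strictly ascending chain x_0 < x_1 < ... < x_n of length n in O_σ
Chain : Ty → ℕ → Set
Chain σ n = Σ (ℕ → O σ) (λ c → ∀ i → i < n → Lt σ (c i) (c (suc i)))

IsHeight : Ty → ℕ → Set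
IsHeight σ h = Chain σ h × (∀ n → Chain σ n → n ≤ h)

e : ℕ → ℕ → ℕ
e m n = if n ≡ᵇ m then 1 else 0

-- Interpret λY in the monotone model O, with Y as the least fixed point, reached by Kleene
-- iteration because every O σ is finite. By soundness, a term F defining e_m is a monotone map
-- with F ⌜m⌝ = ⌜1⌝ and F ⌜m + m!⌝ = ⌜0⌝. For f : O (α ⇒ α) and x : O α, if x, f x, …, f^m x
-- were pairwise distinct, then, listing them so that no point lies below a later one, the
-- indicators of the upsets generated by their initial segments would form a chain of length
-- m + 1 > h(α → α) in O (α ⇒ α). So the orbit repeats within m steps, with a period dividing m!,
-- whence ⌜m⌝ ≤ ⌜m + m!⌝ in the model and so ⌜1⌝ ≤ ⌜0⌝, which fails at f = ⊤, x = ⊥.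
{-# OPTIONS --safe #-}
module Submission where

open import Defs
open import Data.Nat using (ℕ; zero; suc; s≤s; _+_; _*_; _^_; _<_; _≤_; _≤′_; ≤′-refl; ≤′-step; _≡ᵇ_; _!)
open import Data.Nat.Properties
  using (≤-trans; ≤-reflexive; ≤-pred; <⇒≤; ≤⇒≤′; n<1+n; 1+n≰n; m≤m+n; m≤n+m; m<m+n; m≤n⇒m≤1+n;
         >⇒≢; +-comm; +-assoc; +-suc; +-identityʳ; 1≤n!; ≡ᵇ⇒≡; ≡⇒≡ᵇ)
open import Data.Nat.Divisibility using (_∣_; divides; m∣m*n; ∣-trans; m≤n⇒m!∣n!)
open import Data.Bool using (Bool; true; false; _∨_)
open import Data.Fin using (Fin; zero; suc; toℕ; finToFun; funToFin)
open import Data.Fin.Properties using (finToFun-funToFin; all?; pigeonhole; toℕ<n)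
open import Data.List using (List; []; _∷_; take; length)
open import Data.List.Membership.Propositional using (_∈_)
open import Data.List.Relation.Unary.All using (All; []; _∷_) renaming (lookup to All-lookup; map to All-map)
open import Data.List.Relation.Unary.All.Properties using (¬Any⇒All¬)
open import Data.List.Relation.Unary.AllPairs using (AllPairs; []; _∷_)
open import Data.List.Relation.Unary.Any using (Any; here; there; any?) renaming (map to Any-map)
open import Data.Product using (Σ; _×_; _,_; proj₁; proj₂)
open import Data.Sum using (_⊎_; inj₁; inj₂)
open import Data.Empty using (⊥-elim)
open import Data.Unit using (tt)
open import Function using (_∘_)
open import Level using (0ℓ)
open import Relation.Binary.Bundles using (Preorder)
open import Relation.Binary.PropositionalEquality
  using (_≡_; _≢_; _≗_; refl; sym; trans; cong; subst₂; isEquivalence)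
  renaming (subst to ≡-subst)
import Relation.Binary.Reasoning.Preorder as PreorderReasoning
open import Relation.Nullary using (¬_; Dec; yes; no)

Le-refl : ∀ σ x → Le σ x x
Le-refl o       false   = ff≤
Le-refl o       true    = tt≤tt
Le-refl (σ ⇒ τ) (f , _) = λ x → Le-refl τ (f x)

Le-trans : ∀ σ {x y z} → Le σ x y → Le σ y z → Le σ x z
Le-trans o       ff≤   _     = ff≤
Le-trans o       tt≤tt tt≤tt = tt≤tt
Le-trans (σ ⇒ τ) f≤g   g≤h   = λ x → Le-trans τ (f≤g x) (g≤h x)

O-preorder : Ty → Preorder 0ℓ 0ℓ 0ℓ
O-preorder σ = record
  { Carrier    = O σ
  ; _≈_        = _≡_
  ; _≲_        = Le σ
  ; isPreorder = record
    { isEquivalence = isEquivalence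
    ; reflexive     = λ { refl → Le-refl σ _ }
    ; trans         = Le-trans σ
    }
  }

module ≤-Reasoning (σ : Ty) = PreorderReasoning (O-preorder σ)

record Eq (σ : Ty) (x y : O σ) : Set where
  constructor _,_
  field
    ≤ : Le σ x y
    ≥ : Le σ y x

Eq-refl : ∀ σ x → Eq σ x x
Eq-refl σ x = Le-refl σ x , Le-refl σ x

Eq-sym : ∀ {σ x y} → Eq σ x y → Eq σ y x
Eq-sym (x≤y , y≤x) = y≤x , x≤y

Eq-trans : ∀ {σ x y z} → Eq σ x y → Eq σ y z → Eq σ x z
Eq-trans {σ} (x≤y , y≤x) (y≤z , z≤y) = Le-trans σ x≤y y≤z , Le-trans σ z≤y y≤x

Eq-respʳ-≡ : ∀ {σ x y z} → y ≡ z → Eq σ x y → Eq σ x z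
Eq-respʳ-≡ refl x≃y = x≃y

Eq-pointwise : ∀ {σ τ} {f g : O (σ ⇒ τ)} → (∀ a → Eq τ (proj₁ f a) (proj₁ g a)) → Eq (σ ⇒ τ) f g
Eq-pointwise f≃g = (λ a → Eq.≤ (f≃g a)) , (λ a → Eq.≥ (f≃g a))

apply-monotonic : ∀ σ τ {f g : O (σ ⇒ τ)} {a b} → Le (σ ⇒ τ) f g → Le σ a b → Le τ (proj₁ f a) (proj₁ g b)
apply-monotonic σ τ {f} f≤g a≤b = Le-trans τ (proj₂ f _ _ a≤b) (f≤g _)

Eq-apply : ∀ {σ τ} {f g : O (σ ⇒ τ)} {a b} → Eq (σ ⇒ τ) f g → Eq σ a b → Eq τ (proj₁ f a) (proj₁ g b)
Eq-apply {σ} {τ} {f} {g} (f≤g , g≤f) (a≤b , b≤a) =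
  apply-monotonic σ τ {f} {g} f≤g a≤b , apply-monotonic σ τ {g} {f} g≤f b≤a

bot : ∀ σ → O σ
bot o       = false
bot (σ ⇒ τ) = (λ _ → bot τ) , λ _ _ _ → Le-refl τ (bot τ)

top : ∀ σ → O σ
top o       = true
top (σ ⇒ τ) = (λ _ → top τ) , λ _ _ _ → Le-refl τ (top τ)

bot-least : ∀ σ x → Le σ (bot σ) x
bot-least o       _       = ff≤
bot-least (σ ⇒ τ) (f , _) = λ x → bot-least τ (f x)

top≰bot : ∀ σ → ¬ Le σ (top σ) (bot σ)
top≰bot o       ()
top≰bot (σ ⇒ τ) top≤bot = top≰bot τ (top≤bot (bot σ))

mutual
  join : ∀ σ → O σ → O σ → O σ
  join o       a       b       = a ∨ b
  join (σ ⇒ τ) (f , f-mono) (g , g-mono) =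
    (λ x → join τ (f x) (g x)) , λ x y x≤y → join-monotonic τ (f-mono x y x≤y) (g-mono x y x≤y)

  join-monotonic : ∀ σ {a a' b b'} → Le σ a a' → Le σ b b' → Le σ (join σ a b) (join σ a' b')
  join-monotonic σ a≤a' b≤b' =
    join-least σ (Le-trans σ a≤a' (x≤join σ _ _)) (Le-trans σ b≤b' (y≤join σ _ _))

  x≤join : ∀ σ x y → Le σ x (join σ x y)
  x≤join o       false   _       = ff≤
  x≤join o       true    _       = tt≤tt
  x≤join (σ ⇒ τ) (f , _) (g , _) = λ x → x≤join τ (f x) (g x)

  y≤join : ∀ σ x y → Le σ y (join σ x y)
  y≤join o       _       false   = ff≤
  y≤join o       false   true    = tt≤tt
  y≤join o       true    true    = tt≤tt
  y≤join (σ ⇒ τ) (f , _) (g , _) = λ x → y≤join τ (f x) (g x)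

  join-least : ∀ σ {x y z} → Le σ x z → Le σ y z → Le σ (join σ x y) z
  join-least o       {false} _   y≤z = y≤z
  join-least o       {true}  x≤z _   = x≤z
  join-least (σ ⇒ τ) x≤z     y≤z     = λ x → join-least τ (x≤z x) (y≤z x)

⋁ : ∀ τ n → (Fin n → O τ) → O τ
⋁ τ zero    _ = bot τ
⋁ τ (suc n) v = join τ (v zero) (⋁ τ n (v ∘ suc))

⋁-upper : ∀ τ n v i → Le τ (v i) (⋁ τ n v)
⋁-upper τ (suc n) v zero    = x≤join τ _ _
⋁-upper τ (suc n) v (suc i) = Le-trans τ (⋁-upper τ n (v ∘ suc) i) (y≤join τ _ _)

⋁-least : ∀ τ n v {u} → (∀ i → Le τ (v i) u) → Le τ (⋁ τ n v) u
⋁-least τ zero    v v≤u = bot-least τ _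
⋁-least τ (suc n) v v≤u = join-least τ (v≤u zero) (⋁-least τ n (v ∘ suc) (v≤u ∘ suc))

⋁-monotonic : ∀ τ n {v w} → (∀ i → Le τ (v i) (w i)) → Le τ (⋁ τ n v) (⋁ τ n w)
⋁-monotonic τ n {v} {w} v≤w = ⋁-least τ n v (λ i → Le-trans τ (v≤w i) (⋁-upper τ n w i))

guard : ∀ τ {P : Set} → Dec P → O τ → O τ
guard τ (yes _) v = v
guard τ (no _)  _ = bot τ

≤-guard : ∀ τ {P} (p? : Dec P) v → P → Le τ v (guard τ p? v)
≤-guard τ (yes _) v _ = Le-refl τ v
≤-guard τ (no ¬p) v p = ⊥-elim (¬p p)

guard-≤ : ∀ τ {P} (p? : Dec P) {v u} → (P → Le τ v u) → Le τ (guard τ p? v) u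
guard-≤ τ (yes p) v≤u = v≤u p
guard-≤ τ (no _)  _   = bot-least τ _

guard-monotonic : ∀ τ {P Q} (p? : Dec P) (q? : Dec Q) v → (P → Q) → Le τ (guard τ p? v) (guard τ q? v)
guard-monotonic τ p? q? v P→Q = guard-≤ τ p? (λ p → ≤-guard τ q? v (P→Q p))

record Finite (σ : Ty) : Set where
  field
    size       : ℕ
    enum       : Fin size → O σ
    index      : O σ → Fin size
    enum-index : ∀ x → Eq σ (enum (index x)) x
    _≤?_       : ∀ x y → Dec (Le σ x y)

  _≃?_ : ∀ x y → Dec (Eq σ x y)
  x ≃? y with x ≤? y | y ≤? x
  ... | yes x≤y | yes y≤x = yes (x≤y , y≤x)
  ... | no  x≰y | _       = no (x≰y ∘ Eq.≤)
  ... | yes _   | no  y≰x = no (y≰x ∘ Eq.≥)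

finite-o : Finite o
finite-o = record { size = 2 ; enum = enum ; index = index ; enum-index = enum-index ; _≤?_ = _≤?_ }
  where
  enum : Fin 2 → Bool
  enum zero    = false
  enum (suc _) = true

  index : Bool → Fin 2
  index false = zero
  index true  = suc zero

  enum-index : ∀ b → Eq o (enum (index b)) b
  enum-index false = Eq-refl o false
  enum-index true  = Eq-refl o true

  _≤?_ : ∀ a b → Dec (a ≤B b)
  false ≤? _     = yes ff≤
  true  ≤? false = no λ ()
  true  ≤? true  = yes tt≤tt

finite-⇒ : ∀ {σ τ} → Finite σ → Finite τ → Finite (σ ⇒ τ)
finite-⇒ {σ} {τ} A B = record
  { size       = B.size ^ A.size
  ; enum       = fromTable ∘ finToFun
  ; index      = funToFin ∘ table
  ; enum-index = λ f → fromTable-table f (finToFun-funToFin (table f))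
  ; _≤?_       = _≤?_
  }
  where
  module A = Finite A
  module B = Finite B
  open ≤-Reasoning τ

  -- A monotone map is recovered from its values on the enumeration as the join of these step functions.
  step : (Fin A.size → Fin B.size) → O σ → Fin A.size → O τ
  step t x i = guard τ (A.enum i A.≤? x) (B.enum (t i))

  fromTable : (Fin A.size → Fin B.size) → O (σ ⇒ τ)
  fromTable t = (λ x → ⋁ τ A.size (step t x))
              , λ x y x≤y → ⋁-monotonic τ A.size λ i →
                  guard-monotonic τ (A.enum i A.≤? x) (A.enum i A.≤? y) _ (λ eᵢ≤x → Le-trans σ eᵢ≤x x≤y)

  table : O (σ ⇒ τ) → Fin A.size → Fin B.size
  table (f , _) i = B.index (f (A.enum i))

  fromTable-table : ∀ f {t} → t ≗ table f → Eq (σ ⇒ τ) (fromTable t) f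
  fromTable-table (f , f-mono) {t} t≗ = below , above
    where
    entry : ∀ i → Eq τ (B.enum (t i)) (f (A.enum i))
    entry i rewrite t≗ i = B.enum-index _

    below : Le (σ ⇒ τ) (fromTable t) (f , f-mono)
    below x = ⋁-least τ A.size _ λ i →
      guard-≤ τ (A.enum i A.≤? x) λ eᵢ≤x → Le-trans τ (Eq.≤ (entry i)) (f-mono _ _ eᵢ≤x)

    above : Le (σ ⇒ τ) (f , f-mono) (fromTable t)
    above x = begin
      f x                     ≲⟨ f-mono _ _ (Eq.≥ (A.enum-index x)) ⟩
      f (A.enum i)            ≲⟨ Eq.≥ (entry i) ⟩
      B.enum (t i)            ≲⟨ ≤-guard τ (A.enum i A.≤? x) _ (Eq.≤ (A.enum-index x)) ⟩
      step t x i              ≲⟨ ⋁-upper τ A.size (step t x) i ⟩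
      proj₁ (fromTable t) x   ∎
      where i = A.index x

  _≤?_ : ∀ f g → Dec (Le (σ ⇒ τ) f g)
  (f , f-mono) ≤? (g , g-mono) with all? (λ i → f (A.enum i) B.≤? g (A.enum i))
  ... | no  ≰-somewhere = no λ f≤g → ≰-somewhere (λ i → f≤g (A.enum i))
  ... | yes ≤-on-enum   = yes λ x → begin
        f x                    ≲⟨ f-mono _ _ (Eq.≥ (A.enum-index x)) ⟩
        f (A.enum (A.index x)) ≲⟨ ≤-on-enum (A.index x) ⟩
        g (A.enum (A.index x)) ≲⟨ g-mono _ _ (Eq.≤ (A.enum-index x)) ⟩
        g x                    ∎

finite : ∀ σ → Finite σ
finite o       = finite-o
finite (σ ⇒ τ) = finite-⇒ (finite σ) (finite τ)

iterate : ∀ {σ} → O (σ ⇒ σ) → ℕ → O σ → O σ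
iterate f zero    x = x
iterate f (suc n) x = proj₁ f (iterate f n x)

iterate-monotonic : ∀ σ {f g : O (σ ⇒ σ)} {x y} → Le (σ ⇒ σ) f g → Le σ x y →
                    ∀ n → Le σ (iterate f n x) (iterate g n y)
iterate-monotonic σ         f≤g x≤y zero    = x≤y
iterate-monotonic σ {f} {g} f≤g x≤y (suc n) =
  apply-monotonic σ σ {f} {g} f≤g (iterate-monotonic σ f≤g x≤y n)

module _ {σ : Ty} (f : O (σ ⇒ σ)) (x : O σ) where

  iterate-step : Le σ x (proj₁ f x) → ∀ n → Le σ (iterate f n x) (iterate f (suc n) x)
  iterate-step x≤fx zero    = x≤fx
  iterate-step x≤fx (suc n) = proj₂ f _ _ (iterate-step x≤fx n)

  iterate-ascending : Le σ x (proj₁ f x) → ∀ {a b} → a ≤′ b → Le σ (iterate f a x) (iterate f b x)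
  iterate-ascending x≤fx ≤′-refl           = Le-refl σ _
  iterate-ascending x≤fx (≤′-step {b} a≤b) =
    Le-trans σ (iterate-ascending x≤fx a≤b) (iterate-step x≤fx b)

  iterate-stable : ∀ {a n} → a ≤′ n → Le σ (iterate f (suc a) x) (iterate f a x) →
                   Le σ (iterate f (suc n) x) (iterate f n x)
  iterate-stable ≤′-refl        fixed = fixed
  iterate-stable (≤′-step a≤n) fixed = proj₂ f _ _ (iterate-stable a≤n fixed)

module _ (σ : Ty) where
  open Finite (finite σ)

  kleene : O (σ ⇒ σ) → ℕ → O σ
  kleene f n = iterate f n (bot σ)

  lfp : O ((σ ⇒ σ) ⇒ σ)
  lfp = (λ f → kleene f size) , λ f g f≤g → iterate-monotonic σ f≤g (Le-refl σ _) size

  -- Two of the first size + 1 Kleene iterates have the same index, so the iteration has stopped growing.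
  lfp-fixed : ∀ f → Eq σ (proj₁ f (proj₁ lfp f)) (proj₁ lfp f)
  lfp-fixed f with pigeonhole (n<1+n size) (λ j → index (kleene f (toℕ j)))
  ... | i , j , i<j , same-index =
    iterate-stable f (bot σ) (≤⇒≤′ (≤-pred (toℕ<n i))) repeat , iterate-step f (bot σ) (bot-least σ _) size
    where
    open ≤-Reasoning σ
    repeat : Le σ (kleene f (suc (toℕ i))) (kleene f (toℕ i))
    repeat = begin
      kleene f (suc (toℕ i))          ≲⟨ iterate-ascending f (bot σ) (bot-least σ _) (≤⇒≤′ i<j) ⟩
      kleene f (toℕ j)                ≲⟨ Eq.≥ (enum-index (kleene f (toℕ j))) ⟩
      enum (index (kleene f (toℕ j))) ≡⟨ cong enum same-index ⟨
      enum (index (kleene f (toℕ i))) ≲⟨ Eq.≤ (enum-index (kleene f (toℕ i))) ⟩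
      kleene f (toℕ i)                ∎

Env : Ctx → Set
Env Γ = ∀ {σ} → Γ ∋ σ → O σ

∅ : Env []
∅ ()

_▸_ : ∀ {Γ τ} → Env Γ → O τ → Env (τ ∷ Γ)
(δ ▸ a) Z     = a
(δ ▸ a) (S x) = δ x

_≤ᵉ_ : ∀ {Γ} → Env Γ → Env Γ → Set
_≤ᵉ_ {Γ} δ δ' = ∀ {σ} (x : Γ ∋ σ) → Le σ (δ x) (δ' x)

≤ᵉ-refl : ∀ {Γ} {δ : Env Γ} → δ ≤ᵉ δ
≤ᵉ-refl {δ = δ} {σ} x = Le-refl σ (δ x)

▸-monotonic : ∀ {Γ τ} {δ δ' : Env Γ} {a b : O τ} → δ ≤ᵉ δ' → Le τ a b → (δ ▸ a) ≤ᵉ (δ' ▸ b)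
▸-monotonic δ≤δ' a≤b Z     = a≤b
▸-monotonic δ≤δ' a≤b (S x) = δ≤δ' x

mutual
  ⟦_⟧ : ∀ {Γ σ} → Tm Γ σ → Env Γ → O σ
  ⟦ var x ⟧   δ = δ x
  ⟦ lam M ⟧   δ = (λ a → ⟦ M ⟧ (δ ▸ a))
                , λ a b a≤b → ⟦⟧-monotonic M (▸-monotonic (≤ᵉ-refl {δ = δ}) a≤b)
  ⟦ app M N ⟧ δ = proj₁ (⟦ M ⟧ δ) (⟦ N ⟧ δ)
  ⟦ Y σ ⟧     δ = lfp σ

  ⟦⟧-monotonic : ∀ {Γ σ} (M : Tm Γ σ) {δ δ' : Env Γ} → δ ≤ᵉ δ' → Le σ (⟦ M ⟧ δ) (⟦ M ⟧ δ')
  ⟦⟧-monotonic (var x) δ≤δ' = δ≤δ' x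
  ⟦⟧-monotonic (lam M) δ≤δ' = λ a → ⟦⟧-monotonic M (▸-monotonic δ≤δ' (Le-refl _ a))
  ⟦⟧-monotonic (app {σ = σ} {τ} M N) {δ} {δ'} δ≤δ' =
    apply-monotonic σ τ {⟦ M ⟧ δ} {⟦ M ⟧ δ'} (⟦⟧-monotonic M δ≤δ') (⟦⟧-monotonic N δ≤δ')
  ⟦⟧-monotonic (Y σ)   _    = Le-refl _ (lfp σ)

⟦rename⟧ : ∀ {Γ Δ σ} (ρ : ∀ {τ} → Γ ∋ τ → Δ ∋ τ) (M : Tm Γ σ) {δ : Env Γ} {δ' : Env Δ} →
           (∀ {τ} (x : Γ ∋ τ) → Eq τ (δ x) (δ' (ρ x))) → Eq σ (⟦ M ⟧ δ) (⟦ rename ρ M ⟧ δ')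
⟦rename⟧ ρ (var x)   δ≃ = δ≃ x
⟦rename⟧ ρ (lam M)   δ≃ = Eq-pointwise λ a → ⟦rename⟧ (ext ρ) M λ { Z → Eq-refl _ a ; (S x) → δ≃ x }
⟦rename⟧ ρ (app M N) δ≃ = Eq-apply (⟦rename⟧ ρ M δ≃) (⟦rename⟧ ρ N δ≃)
⟦rename⟧ ρ (Y σ)     _  = Eq-refl _ (lfp σ)

⟦weaken⟧ : ∀ {Γ σ τ} (M : Tm Γ σ) {δ : Env Γ} {a : O τ} → Eq σ (⟦ M ⟧ δ) (⟦ weaken M ⟧ (δ ▸ a))
⟦weaken⟧ M {δ} = ⟦rename⟧ S M λ {τ} x → Eq-refl τ (δ x)

⟦subst⟧ : ∀ {Γ Δ σ} (s : ∀ {τ} → Γ ∋ τ → Tm Δ τ) (M : Tm Γ σ) {δ : Env Γ} {δ' : Env Δ} →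
          (∀ {τ} (x : Γ ∋ τ) → Eq τ (δ x) (⟦ s x ⟧ δ')) → Eq σ (⟦ M ⟧ δ) (⟦ subst s M ⟧ δ')
⟦subst⟧ s (var x)   δ≃ = δ≃ x
⟦subst⟧ s (lam M)   δ≃ = Eq-pointwise λ a →
  ⟦subst⟧ (exts s) M λ { Z → Eq-refl _ a ; (S x) → Eq-trans (δ≃ x) (⟦weaken⟧ (s x)) }
⟦subst⟧ s (app M N) δ≃ = Eq-apply (⟦subst⟧ s M δ≃) (⟦subst⟧ s N δ≃)
⟦subst⟧ s (Y σ)     _  = Eq-refl _ (lfp σ)

⟦⟧-sound : ∀ {Γ σ} {M N : Tm Γ σ} → M ≈ N → (δ : Env Γ) → Eq σ (⟦ M ⟧ δ) (⟦ N ⟧ δ)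
⟦⟧-sound (β M N)      δ = ⟦subst⟧ (single N) M λ { Z → Eq-refl _ _ ; (S x) → Eq-refl _ _ }
⟦⟧-sound (η M)        δ = Eq-pointwise λ a → Eq-sym (Eq-apply (⟦weaken⟧ M) (Eq-refl _ a))
⟦⟧-sound (Yc f)       δ = lfp-fixed _ (⟦ f ⟧ δ)
⟦⟧-sound ≈refl        δ = Eq-refl _ _
⟦⟧-sound (≈sym p)     δ = Eq-sym (⟦⟧-sound p δ)
⟦⟧-sound (≈trans p q) δ = Eq-trans (⟦⟧-sound p δ) (⟦⟧-sound q δ)
⟦⟧-sound (ξlam p)     δ = Eq-pointwise λ a → ⟦⟧-sound p (δ ▸ a)
⟦⟧-sound (ξapp p q)   δ = Eq-apply (⟦⟧-sound p δ) (⟦⟧-sound q δ)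

⟦num⟧ : ∀ {α} n (f : O (α ⇒ α)) x → proj₁ (proj₁ (⟦ num α n ⟧ ∅) f) x ≡ iterate f n x
⟦num⟧ zero    f x = refl
⟦num⟧ (suc n) f x = cong (proj₁ f) (⟦num⟧ n f x)

Any-take-suc : ∀ {A : Set} {P : A → Set} k xs → Any P (take k xs) → Any P (take (suc k) xs)
Any-take-suc (suc k) (x ∷ xs) (here p)  = here p
Any-take-suc (suc k) (x ∷ xs) (there p) = there (Any-take-suc k xs p)

Distinct : ∀ σ → List (O σ) → Set
Distinct σ = AllPairs (λ a b → ¬ Eq σ a b)

module _ (α : Ty) where
  open Finite (finite α) using (_≤?_)

  private
    _≰_ : O α → O α → Set
    a ≰ b = ¬ Le α a b

  insert : O α → List (O α) → List (O α)
  insert y []       = y ∷ []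
  insert y (z ∷ zs) with z ≤? y
  ... | yes _ = y ∷ z ∷ zs
  ... | no  _ = z ∷ insert y zs

  insert-length : ∀ y zs → length (insert y zs) ≡ suc (length zs)
  insert-length y []       = refl
  insert-length y (z ∷ zs) with z ≤? y
  ... | yes _ = refl
  ... | no  _ = cong suc (insert-length y zs)

  All-insert : ∀ {P : O α → Set} {y} zs → P y → All P zs → All P (insert y zs)
  All-insert         []       py []         = py ∷ []
  All-insert {y = y} (z ∷ zs) py (pz ∷ pzs) with z ≤? y
  ... | yes _ = py ∷ pz ∷ pzs
  ... | no  _ = pz ∷ All-insert zs py pzs

  insert-sorted : ∀ {y} zs → All (λ z → ¬ Eq α y z) zs → AllPairs _≰_ zs → AllPairs _≰_ (insert y zs)
  insert-sorted         []       _           _              = [] ∷ []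
  insert-sorted {y = y} (z ∷ zs) (y≄z ∷ y≄zs) (z≰zs ∷ sorted) with z ≤? y
  ... | yes z≤y = ((λ y≤z → y≄z (y≤z , z≤y)) ∷ All-map (λ z≰w y≤w → z≰w (Le-trans α z≤y y≤w)) z≰zs)
                  ∷ z≰zs ∷ sorted
  ... | no  z≰y = All-insert zs z≰y z≰zs ∷ insert-sorted zs y≄zs sorted

  sort : List (O α) → List (O α)
  sort []       = []
  sort (y ∷ ys) = insert y (sort ys)

  sort-length : ∀ ys → length (sort ys) ≡ length ys
  sort-length []       = refl
  sort-length (y ∷ ys) = trans (insert-length y (sort ys)) (cong suc (sort-length ys))

  All-sort : ∀ {P : O α → Set} ys → All P ys → All P (sort ys)
  All-sort []       []         = []
  All-sort (y ∷ ys) (py ∷ pys) = All-insert (sort ys) py (All-sort ys pys)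

  sort-sorted : ∀ {ys} → Distinct α ys → AllPairs _≰_ (sort ys)
  sort-sorted {[]}     []                 = []
  sort-sorted {y ∷ ys} (y≄ys ∷ distinct) = insert-sorted (sort ys) (All-sort ys y≄ys) (sort-sorted distinct)

  below? : ∀ ws z → Dec (Any (λ w → Le α w z) ws)
  below? ws z = any? (_≤? z) ws

  upset-indicator : List (O α) → O (α ⇒ α)
  upset-indicator ws = (λ z → guard α (below? ws z) (top α))
                     , λ z z' z≤z' → guard-monotonic α (below? ws z) (below? ws z') _
                                       (Any-map λ w≤z → Le-trans α w≤z z≤z')

  fresh-element : ∀ {zs} → AllPairs _≰_ zs → ∀ k → k < length zs →
                  Σ (O α) λ u → u ∈ zs × Any (λ w → Le α w u) (take (suc k) zs)
                                       × ¬ Any (λ w → Le α w u) (take k zs)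
  fresh-element {z ∷ zs} _                  zero    _         = z , here refl , here (Le-refl α z) , λ ()
  fresh-element {z ∷ zs} (z≰zs ∷ sorted) (suc k) (s≤s k<n) with fresh-element sorted k k<n
  ... | u , u∈zs , new , old = u , there u∈zs , there new , λ where
    (here z≤u) → All-lookup z≰zs u∈zs z≤u
    (there p)  → old p

  -- Strictness at step k is witnessed by the k-th element, since no earlier element lies below it.
  upset-chain : ∀ {zs} → AllPairs _≰_ zs → Chain (α ⇒ α) (length zs)
  upset-chain {zs} sorted = (λ k → upset-indicator (take k zs)) , λ k k<n → ascending k , strict k k<n
    where
    ascending : ∀ k → Le (α ⇒ α) (upset-indicator (take k zs)) (upset-indicator (take (suc k) zs))
    ascending k z = guard-monotonic α (below? (take k zs) z) (below? (take (suc k) zs) z) _ (Any-take-suc k zs)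

    strict : ∀ k → k < length zs → ¬ Le (α ⇒ α) (upset-indicator (take (suc k) zs)) (upset-indicator (take k zs))
    strict k k<n le with fresh-element sorted k k<n
    ... | u , _ , new , old = top≰bot α (begin
      top α                                      ≲⟨ ≤-guard α (below? (take (suc k) zs) u) _ new ⟩
      proj₁ (upset-indicator (take (suc k) zs)) u ≲⟨ le u ⟩
      proj₁ (upset-indicator (take k zs)) u       ≲⟨ guard-≤ α (below? (take k zs) u) (⊥-elim ∘ old) ⟩
      bot α                                      ∎)
      where open ≤-Reasoning α

  distinct-chain : ∀ {ys} → Distinct α ys → Chain (α ⇒ α) (length ys)
  distinct-chain {ys} distinct = ≡-subst (Chain (α ⇒ α)) (sort-length ys) (upset-chain (sort-sorted distinct))

module _ {σ : Ty} (f : O (σ ⇒ σ)) (x : O σ) where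

  orbit : ℕ → List (O σ)
  orbit zero    = iterate f zero x ∷ []
  orbit (suc n) = iterate f (suc n) x ∷ orbit n

  orbit-length : ∀ n → length (orbit n) ≡ suc n
  orbit-length zero    = refl
  orbit-length (suc n) = cong suc (orbit-length n)

  Any-orbit : ∀ {P : O σ → Set} n → Any P (orbit n) → Σ ℕ λ i → Σ ℕ λ k → i + k ≡ n × P (iterate f i x)
  Any-orbit zero    (here p)  = 0 , 0 , refl , p
  Any-orbit (suc n) (here p)  = suc n , 0 , +-identityʳ (suc n) , p
  Any-orbit (suc n) (there p) with Any-orbit n p
  ... | i , k , i+k≡n , q = i , suc k , trans (+-suc i k) (cong suc i+k≡n) , q

  Eq-reindex : ∀ {a j j'} → j ≡ j' → Eq σ a (iterate f j x) → Eq σ a (iterate f j' x)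
  Eq-reindex j≡j' = Eq-respʳ-≡ (cong (λ j → iterate f j x) j≡j')

  Repetition : ℕ → Set
  Repetition n = Σ ℕ λ i → Σ ℕ λ d → i + suc d ≤ n × Eq σ (iterate f i x) (iterate f (i + suc d) x)

  repetition-or-distinct : ∀ n → Repetition n ⊎ Distinct σ (orbit n)
  repetition-or-distinct zero = inj₂ ([] ∷ [])
  repetition-or-distinct (suc n) with repetition-or-distinct n
  ... | inj₁ (i , d , i+1+d≤n , e) = inj₁ (i , d , m≤n⇒m≤1+n i+1+d≤n , e)
  ... | inj₂ distinct with any? (Finite._≃?_ (finite σ) (iterate f (suc n) x)) (orbit n)
  ...   | no  new  = inj₂ (¬Any⇒All¬ (orbit n) new ∷ distinct)
  ...   | yes seen with Any-orbit n seen
  ...     | i , k , i+k≡n , e = inj₁ (i , k , ≤-reflexive i+1+k≡1+n , Eq-reindex (sym i+1+k≡1+n) (Eq-sym e))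
    where
    i+1+k≡1+n : i + suc k ≡ suc n
    i+1+k≡1+n = trans (+-suc i k) (cong suc i+k≡n)

  module _ {i d : ℕ} (period : Eq σ (iterate f i x) (iterate f (i + d) x)) where

    period-from : ∀ {n} → i ≤′ n → Eq σ (iterate f n x) (iterate f (n + d) x)
    period-from ≤′-refl        = period
    period-from (≤′-step i≤n) = Eq-apply (Eq-refl (σ ⇒ σ) f) (period-from i≤n)

    period-multiple : ∀ {n} → i ≤ n → ∀ q → Eq σ (iterate f n x) (iterate f (q * d + n) x)
    period-multiple         i≤n zero    = Eq-refl σ _
    period-multiple {n = n} i≤n (suc q) = Eq-trans (period-multiple i≤n q)
      (Eq-reindex rearrange (period-from (≤⇒≤′ (≤-trans i≤n (m≤n+m n (q * d))))))
      where
      rearrange : q * d + n + d ≡ suc q * d + n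
      rearrange = trans (+-comm (q * d + n) d) (sym (+-assoc d (q * d) n))

1+d≤m⇒1+d∣m! : ∀ {d m} → suc d ≤ m → suc d ∣ m !
1+d≤m⇒1+d∣m! {d} 1+d≤m = ∣-trans (m∣m*n (d !)) (m≤n⇒m!∣n! 1+d≤m)

repetition-period : ∀ {σ} (f : O (σ ⇒ σ)) x {m} → Repetition f x m →
                    Eq σ (iterate f m x) (iterate f (m + m !) x)
repetition-period f x {m} (i , d , i+1+d≤m , e) with 1+d≤m⇒1+d∣m! (≤-trans (m≤n+m (suc d) i) i+1+d≤m)
... | divides q m!≡q*[1+d] =
  Eq-reindex f x q*[1+d]+m≡m+m! (period-multiple f x e (≤-trans (m≤m+n i (suc d)) i+1+d≤m) q)
  where
  q*[1+d]+m≡m+m! : q * suc d + m ≡ m + m !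
  q*[1+d]+m≡m+m! = trans (cong (_+ m) (sym m!≡q*[1+d])) (+-comm (m !) m)

-- An orbit with m + 1 distinct points would give a chain of length m + 1 in O (α ⇒ α).
iterate-m≃iterate-m+m! : ∀ {α h m} → (∀ n → Chain (α ⇒ α) n → n ≤ h) → h < m →
                          ∀ f x → Eq α (iterate f m x) (iterate f (m + m !) x)
iterate-m≃iterate-m+m! {α} {h} {m} bounded h<m f x with repetition-or-distinct f x m
... | inj₁ repetition = repetition-period f x repetition
... | inj₂ distinct   = ⊥-elim (1+n≰n (≤-trans 1+m≤h (<⇒≤ h<m)))
  where
  1+m≤h : suc m ≤ h
  1+m≤h = ≡-subst (_≤ h) (orbit-length f x m) (bounded _ (distinct-chain α distinct))

e-at : ∀ m → e m m ≡ 1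
e-at m with m ≡ᵇ m | ≡⇒≡ᵇ m m refl
... | true  | _  = refl
... | false | ()

e-off : ∀ m n → n ≢ m → e m n ≡ 0
e-off m n n≢m with n ≡ᵇ m | ≡ᵇ⇒≡ n m
... | true  | n≡m = ⊥-elim (n≢m (n≡m tt))
... | false | _   = refl

fact1 : (α : Ty) (h m : ℕ) → IsHeight (α ⇒ α) h → h < m → ¬ Definable α (e m)
fact1 α h m (_ , bounded) h<m (F , defines) = top≰bot α (⌜1⌝≤⌜0⌝ (top (α ⇒ α)) (bot α))
  where
  ⌜_⌝ : ℕ → O (ω α)
  ⌜ n ⌝ = ⟦ num α n ⟧ ∅

  ⟦F⟧ : O (ω α ⇒ ω α)
  ⟦F⟧ = ⟦ F ⟧ ∅

  F-value : ∀ n k → e m n ≡ k → Eq (ω α) (proj₁ ⟦F⟧ ⌜ n ⌝) ⌜ k ⌝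
  F-value n k e[n]≡k = ⟦⟧-sound (proj₁ (defines n k) e[n]≡k) ∅

  ⌜m⌝≤⌜m+m!⌝ : Le (ω α) ⌜ m ⌝ ⌜ m + m ! ⌝
  ⌜m⌝≤⌜m+m!⌝ f x = subst₂ (Le α) (sym (⟦num⟧ m f x)) (sym (⟦num⟧ (m + m !) f x))
                         (Eq.≤ (iterate-m≃iterate-m+m! bounded h<m f x))

  m+m!≢m : m + m ! ≢ m
  m+m!≢m = >⇒≢ (m<m+n m (1≤n! m))

  open ≤-Reasoning (ω α)
  ⌜1⌝≤⌜0⌝ : Le (ω α) ⌜ 1 ⌝ ⌜ 0 ⌝
  ⌜1⌝≤⌜0⌝ = begin
    ⌜ 1 ⌝                 ≲⟨ Eq.≥ (F-value m 1 (e-at m)) ⟩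
    proj₁ ⟦F⟧ ⌜ m ⌝       ≲⟨ proj₂ ⟦F⟧ _ _ ⌜m⌝≤⌜m+m!⌝ ⟩
    proj₁ ⟦F⟧ ⌜ m + m ! ⌝ ≲⟨ Eq.≤ (F-value (m + m !) 0 (e-off m (m + m !) m+m!≢m)) ⟩
    ⌜ 0 ⌝                 ∎
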